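{- For every predicate type $\pi$ there exists a bijection $\tau_\pi: [\![\pi]\!]^* \to [\![\pi]\!]^{c}$ with inverse $\tau^{ -1}_\pi: [\![\pi]\!]^{c} \to [\![\pi]\!]^*$, such that both preserve the orderings $\leq$ and $\preceq$ between $[\![\pi]\!]^*$ and $[\![\pi]\!]^{c}$. Moreover, there exists a bijection $\tau: \mathcal{H}_{\mathsf{P}} \to H^{c}_{\mathsf{P}}$ with inverse $\tau^{ -1}: H^{c}_{\mathsf{P}} \to \mathcal{H}_{\mathsf{P}}$, such that both preserve the orderings $\leq$ and $\preceq$ between $\mathcal{H}_{\mathsf{P}}$ and $H^{c}_{\mathsf{P}}$.
   Context: We work with a simply typed higher-order logic programming language with base types $o$ (Booleans) and $\iota$ (individuals); predicate types are $\pi ::= o \mid \rho \to \pi$ and argument types are $\rho ::= \iota \mid \pi$. Fix a program $\mathsf{P}$ with Herbrand universe $U_{\mathsf{P}}$ (its individual constants). The two-valued meaning of types is $[\![o]\!] = \{\mathit{false},\mathit{true}\}$ ordered by $\mathit{false} < \mathit{true}$, $[\![\iota]\!] = U_{\mathsf{P}}$ with the trivial (identity) order, and $[\![\rho\to\pi]\!]$ is the set of all functions $[\![\rho]\!]\to[\![\pi]\!]$ ordered pointwise; each $([\![\pi]\!],\leq_\pi)$ is a complete lattice. The three-valued meaning is $[\![o]\!]^* = \{\mathit{false},\mathit{undef},\mathit{true}\}$ with truth order $\mathit{false} < \mathit{undef} < \mathit{true}$ and precision order $\preceq$ given by $\mathit{undef} \prec \mathit{false}$, $\mathit{undef} \prec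 \mathit{true}$; $[\![\iota]\!]^* = U_{\mathsf{P}}$ with trivial orders; and $[\![\rho\to\pi]\!]^*$ is the set of all functions from the two-valued $[\![\rho]\!]$ to $[\![\pi]\!]^*$, with both $\leq$ and $\preceq$ defined pointwise. For a complete lattice $(L,\leq)$, $L^{c} = \{(x,y)\in L\times L \mid x\leq y\}$, with $(x,y)\leq(x',y')$ iff $x\leq x'$ and $y\leq y'$, and $(x,y)\preceq(x',y')$ iff $x\leq x'$ and $y'\leq y$; $[\![\pi]\!]^{c}$ denotes $L^c$ for $L=[\![\pi]\!]$. A (two-valued) Herbrand interpretation assigns each individual constant to itself and each predicate constant $\mathsf{p}:\pi$ an element of $[\![\pi]\!]$; $H_{\mathsf{P}}$ is the set of these, ordered pointwise on predicate constants (a complete lattice), and $H^c_{\mathsf{P}}$ is the corresponding set of consistent pairs. A three-valued Herbrand interpretation assigns each $\mathsf{p}:\pi$ an element of $[\![\pi]\!]^*$; $\mathcal{H}_{\mathsf{P}}$ is the set of these, with $\leq$ and $\preceq$ defined pointwise on predicate constants. -}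

module Defs where

open import Level using (0ℓ)
open import Data.Bool using (Bool; false; true)
open import Data.Product using (_×_)
open import Relation.Binary.PropositionalEquality using (_≡_)

-- Types of the language:  π ::= o | ρ → π ,  ρ ::= ι | π

mutual
  data PTy : Set where
    o   : PTy
    _⇒_ : ATy → PTy → PTy

  data ATy : Set where
    ι   : ATy
    ⌜_⌝ : PTy → ATy

infixr 5 _⇒_

data _≤B_ : Bool → Bool → Set where
  b≤b : ∀ {b} → b ≤B b
  f≤t : false ≤B true

data V3 : Set where
  false3 undef3 true3 : V3

data _≤3_ : V3 → V3 → Set where
  refl3 : ∀ {v} → v ≤3 v
  f≤u   : false3 ≤3 undef3
  u≤t   : undef3 ≤3 true3
  f≤t3  : false3 ≤3 true3

data _⪯3_ : V3 → V3 → Set where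
  prefl : ∀ {v} → v ⪯3 v
  u⪯f   : undef3 ⪯3 false3
  u⪯t   : undef3 ⪯3 true3

-- Equality is extensional
-- (pointwise) equality, since functions are compared without funext.

record Ord2 : Set₁ where
  field
    Car  : Set
    _≈_  : Car → Car → Set
    _≤_  : Car → Car → Set

record Ord3 : Set₁ where
  field
    Car  : Set
    _≈_  : Car → Car → Set
    _≤_  : Car → Car → Set
    _⪯_  : Car → Car → Set

record ConsPair (L : Ord2) : Set where
  constructor ⟨_,_∣_⟩
  open Ord2 L
  field
    lo : Car
    hi : Car
    ok : lo ≤ hi

Cons : Ord2 → Ord3
Cons L = record
  { Car = ConsPair L
  ; _≈_ = λ a b → (lo a ≈ lo b) × (hi a ≈ hi b)
  ; _≤_ = λ a b → (lo a ≤ lo b) × (hi a ≤ hi b)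
  ; _⪯_ = λ a b → (lo a ≤ lo b) × (hi b ≤ hi a)
  }
  where open Ord2 L ; open ConsPair

record OrderBij (A B : Ord3) : Set where
  module A = Ord3 A
  module B = Ord3 B
  field
    to     : A.Car → B.Car
    from   : B.Car → A.Car
    from-to : ∀ x → from (to x) A.≈ x
    to-from : ∀ y → to (from y) B.≈ y
    to-≤   : ∀ {x x'} → x A.≤ x' → to x B.≤ to x'
    to-⪯   : ∀ {x x'} → x A.⪯ x' → to x B.⪯ to x'
    from-≤ : ∀ {y y'} → y B.≤ y' → from y A.≤ from y'
    from-⪯ : ∀ {y y'} → y B.⪯ y' → from y A.⪯ from y'

-- Meanings of types, relative to a Herbrand universe U

module Sem (U : Set) where

  mutual
    ⟦_⟧ : PTy → Set
    ⟦ o ⟧     = Bool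
    ⟦ ρ ⇒ π ⟧ = ⟦ ρ ⟧A → ⟦ π ⟧

    ⟦_⟧A : ATy → Set
    ⟦ ι ⟧A     = U
    ⟦ ⌜ π ⌝ ⟧A = ⟦ π ⟧

  ⟦_⟧* : PTy → Set
  ⟦ o ⟧*     = V3
  ⟦ ρ ⇒ π ⟧* = ⟦ ρ ⟧A → ⟦ π ⟧*

  Le : (π : PTy) → ⟦ π ⟧ → ⟦ π ⟧ → Set
  Le o       a b = a ≤B b
  Le (ρ ⇒ π) f g = ∀ x → Le π (f x) (g x)

  Eq : (π : PTy) → ⟦ π ⟧ → ⟦ π ⟧ → Set
  Eq o       a b = a ≡ b
  Eq (ρ ⇒ π) f g = ∀ x → Eq π (f x) (g x)

  Le* : (π : PTy) → ⟦ π ⟧* → ⟦ π ⟧* → Set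
  Le* o       a b = a ≤3 b
  Le* (ρ ⇒ π) f g = ∀ x → Le* π (f x) (g x)

  Prec* : (π : PTy) → ⟦ π ⟧* → ⟦ π ⟧* → Set
  Prec* o       a b = a ⪯3 b
  Prec* (ρ ⇒ π) f g = ∀ x → Prec* π (f x) (g x)

  Eq* : (π : PTy) → ⟦ π ⟧* → ⟦ π ⟧* → Set
  Eq* o       a b = a ≡ b
  Eq* (ρ ⇒ π) f g = ∀ x → Eq* π (f x) (g x)

  Two : PTy → Ord2
  Two π = record { Car = ⟦ π ⟧ ; _≈_ = Eq π ; _≤_ = Le π }

  Three : PTy → Ord3
  Three π = record { Car = ⟦ π ⟧* ; _≈_ = Eq* π ; _≤_ = Le* π ; _⪯_ = Prec* π }

  -- Herbrand interpretations of a program whose predicate constants are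
  -- given by the set Pred, each p : Pred having type typeOf p.
  -- H_P (two-valued), ordered pointwise on predicate constants.
  H : (Pred : Set) → (Pred → PTy) → Ord2
  H Pred ty = record
    { Car = (p : Pred) → ⟦ ty p ⟧
    ; _≈_ = λ I J → ∀ p → Eq (ty p) (I p) (J p)
    ; _≤_ = λ I J → ∀ p → Le (ty p) (I p) (J p)
    }

  H3 : (Pred : Set) → (Pred → PTy) → Ord3
  H3 Pred ty = record
    { Car = (p : Pred) → ⟦ ty p ⟧*
    ; _≈_ = λ I J → ∀ p → Eq* (ty p) (I p) (J p)
    ; _≤_ = λ I J → ∀ p → Le* (ty p) (I p) (J p)
    ; _⪯_ = λ I J → ∀ p → Prec* (ty p) (I p) (J p)
    }

{-# OPTIONS --safe #-}
-- A three-valued truth value v is encoded by the consistent Boolean pair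
-- (v = true , v ≠ false); under this encoding the truth order becomes
-- componentwise and the precision order becomes reverse interval inclusion.
-- At function types and for interpretations everything is pointwise, and a
-- function into consistent pairs is the same as a consistent pair of functions.
module Submission where

open import Defs
open import Data.Bool using (Bool; false; true)
open import Data.Product using (_×_; _,_; proj₁; proj₂)
open import Function using (_∘_)
open import Relation.Binary.PropositionalEquality using (_≡_; refl)

open ConsPair

Bool₂ : Ord2
Bool₂ = record { Car = Bool ; _≈_ = _≡_ ; _≤_ = _≤B_ }

V₃ : Ord3
V₃ = record { Car = V3 ; _≈_ = _≡_ ; _≤_ = _≤3_ ; _⪯_ = _⪯3_ }

module _ where
  open Ord3 (Cons Bool₂)

  encode : V3 → ConsPair Bool₂
  encode false3 = ⟨ false , false ∣ b≤b ⟩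
  encode undef3 = ⟨ false , true ∣ f≤t ⟩
  encode true3  = ⟨ true , true ∣ b≤b ⟩

  decode : ConsPair Bool₂ → V3
  decode ⟨ false , .false ∣ b≤b ⟩ = false3
  decode ⟨ true  , .true  ∣ b≤b ⟩ = true3
  decode ⟨ .false , .true ∣ f≤t ⟩ = undef3

  decode-encode : ∀ v → decode (encode v) ≡ v
  decode-encode false3 = refl
  decode-encode undef3 = refl
  decode-encode true3  = refl

  encode-decode : ∀ y → encode (decode y) ≈ y
  encode-decode ⟨ false , .false ∣ b≤b ⟩ = refl , refl
  encode-decode ⟨ true  , .true  ∣ b≤b ⟩ = refl , refl
  encode-decode ⟨ .false , .true ∣ f≤t ⟩ = refl , refl

  encode-≤ : ∀ {v w} → v ≤3 w → encode v ≤ encode w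
  encode-≤ {false3} refl3 = b≤b , b≤b
  encode-≤ {undef3} refl3 = b≤b , b≤b
  encode-≤ {true3}  refl3 = b≤b , b≤b
  encode-≤ f≤u  = b≤b , f≤t
  encode-≤ u≤t  = f≤t , b≤b
  encode-≤ f≤t3 = f≤t , f≤t

  encode-⪯ : ∀ {v w} → v ⪯3 w → encode v ⪯ encode w
  encode-⪯ {false3} prefl = b≤b , b≤b
  encode-⪯ {undef3} prefl = b≤b , b≤b
  encode-⪯ {true3}  prefl = b≤b , b≤b
  encode-⪯ u⪯f = b≤b , f≤t
  encode-⪯ u⪯t = f≤t , b≤b

  decode-≤ : ∀ {y z} → y ≤ z → decode y ≤3 decode z
  decode-≤ {⟨ false , _ ∣ b≤b ⟩} {⟨ false , _ ∣ b≤b ⟩} _ = refl3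
  decode-≤ {⟨ false , _ ∣ b≤b ⟩} {⟨ _ , _ ∣ f≤t ⟩}     _ = f≤u
  decode-≤ {⟨ false , _ ∣ b≤b ⟩} {⟨ true , _ ∣ b≤b ⟩}  _ = f≤t3
  decode-≤ {⟨ _ , _ ∣ f≤t ⟩}     {⟨ false , _ ∣ b≤b ⟩} (_ , ())
  decode-≤ {⟨ _ , _ ∣ f≤t ⟩}     {⟨ _ , _ ∣ f≤t ⟩}     _ = refl3
  decode-≤ {⟨ _ , _ ∣ f≤t ⟩}     {⟨ true , _ ∣ b≤b ⟩}  _ = u≤t
  decode-≤ {⟨ true , _ ∣ b≤b ⟩}  {⟨ false , _ ∣ b≤b ⟩} (() , _)
  decode-≤ {⟨ true , _ ∣ b≤b ⟩}  {⟨ _ , _ ∣ f≤t ⟩}     (() , _)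
  decode-≤ {⟨ true , _ ∣ b≤b ⟩}  {⟨ true , _ ∣ b≤b ⟩}  _ = refl3

  decode-⪯ : ∀ {y z} → y ⪯ z → decode y ⪯3 decode z
  decode-⪯ {⟨ false , _ ∣ b≤b ⟩} {⟨ false , _ ∣ b≤b ⟩} _ = prefl
  decode-⪯ {⟨ false , _ ∣ b≤b ⟩} {⟨ _ , _ ∣ f≤t ⟩}     (_ , ())
  decode-⪯ {⟨ false , _ ∣ b≤b ⟩} {⟨ true , _ ∣ b≤b ⟩}  (_ , ())
  decode-⪯ {⟨ _ , _ ∣ f≤t ⟩}     {⟨ false , _ ∣ b≤b ⟩} _ = u⪯f
  decode-⪯ {⟨ _ , _ ∣ f≤t ⟩}     {⟨ _ , _ ∣ f≤t ⟩}     _ = prefl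
  decode-⪯ {⟨ _ , _ ∣ f≤t ⟩}     {⟨ true , _ ∣ b≤b ⟩}  _ = u⪯t
  decode-⪯ {⟨ true , _ ∣ b≤b ⟩}  {⟨ false , _ ∣ b≤b ⟩} (() , _)
  decode-⪯ {⟨ true , _ ∣ b≤b ⟩}  {⟨ _ , _ ∣ f≤t ⟩}     (() , _)
  decode-⪯ {⟨ true , _ ∣ b≤b ⟩}  {⟨ true , _ ∣ b≤b ⟩}  _ = prefl

truthValueBij : OrderBij V₃ (Cons Bool₂)
truthValueBij = record
  { to = encode ; from = decode
  ; from-to = decode-encode ; to-from = encode-decode
  ; to-≤ = encode-≤ ; to-⪯ = encode-⪯
  ; from-≤ = decode-≤ ; from-⪯ = decode-⪯
  }

module _ {X : Set} where

  Π₂ : (X → Ord2) → Ord2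
  Π₂ L = record
    { Car = ∀ x → Ord2.Car (L x)
    ; _≈_ = λ f g → ∀ x → Ord2._≈_ (L x) (f x) (g x)
    ; _≤_ = λ f g → ∀ x → Ord2._≤_ (L x) (f x) (g x)
    }

  Π₃ : (X → Ord3) → Ord3
  Π₃ A = record
    { Car = ∀ x → Ord3.Car (A x)
    ; _≈_ = λ f g → ∀ x → Ord3._≈_ (A x) (f x) (g x)
    ; _≤_ = λ f g → ∀ x → Ord3._≤_ (A x) (f x) (g x)
    ; _⪯_ = λ f g → ∀ x → Ord3._⪯_ (A x) (f x) (g x)
    }

  module _ {L : X → Ord2} where

    zipCons : (∀ x → ConsPair (L x)) → ConsPair (Π₂ L)
    zipCons p = ⟨ lo ∘ p , hi ∘ p ∣ ok ∘ p ⟩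

    unzipCons : ConsPair (Π₂ L) → ∀ x → ConsPair (L x)
    unzipCons p x = ⟨ lo p x , hi p x ∣ ok p x ⟩

  Π-OrderBij : {A : X → Ord3} {L : X → Ord2}
             → (∀ x → OrderBij (A x) (Cons (L x)))
             → OrderBij (Π₃ A) (Cons (Π₂ L))
  Π-OrderBij τ = record
    { to      = λ f → zipCons λ x → to (τ x) (f x)
    ; from    = λ p x → from (τ x) (unzipCons p x)
    ; from-to = λ f x → from-to (τ x) (f x)
    ; to-from = λ p → split λ x → to-from (τ x) (unzipCons p x)
    ; to-≤    = λ f≤g → split λ x → to-≤ (τ x) (f≤g x)
    ; to-⪯    = λ f⪯g → split λ x → to-⪯ (τ x) (f⪯g x)
    ; from-≤  = λ (lo≤ , hi≤) x → from-≤ (τ x) (lo≤ x , hi≤ x)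
    ; from-⪯  = λ (lo≤ , hi≥) x → from-⪯ (τ x) (lo≤ x , hi≥ x)
    }
    where
    open OrderBij
    split : ∀ {P Q : X → Set} → (∀ x → P x × Q x) → (∀ x → P x) × (∀ x → Q x)
    split h = proj₁ ∘ h , proj₂ ∘ h

module _ (U : Set) where
  open Sem U

  -- Three o, Two o, Three (ρ ⇒ π), Two (ρ ⇒ π), H3 and H are definitionally
  -- V₃, Bool₂ and the Π₃ / Π₂ of constant or typeOf-indexed families.
  τ : (π : PTy) → OrderBij (Three π) (Cons (Two π))
  τ o       = truthValueBij
  τ (ρ ⇒ π) = Π-OrderBij λ (_ : ⟦ ρ ⟧A) → τ π

proposition6p2 : (U : Set)
    → ((π : PTy) → OrderBij (Sem.Three U π) (Cons (Sem.Two U π)))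
      × ((Pred : Set) (typeOf : Pred → PTy)
         → OrderBij (Sem.H3 U Pred typeOf) (Cons (Sem.H U Pred typeOf)))
proposition6p2 U = τ U , λ Pred typeOf → Π-OrderBij (τ U ∘ typeOf)
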